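{- Let $\Gamma$ be a simple assembly graph with exactly $n$ vertices of degree $4$, with enumerated transversal edges $e_1,\dots,e_{2n-1}$, and let $\Phi_\Gamma:\mathcal{C}(\Gamma)\to\{0,1\}^{2n-1}$ be defined by $\Phi_\Gamma(\gamma)[i]=1$ if $e_i$ belongs to some path of $\gamma$ and $0$ otherwise. Then: (1) $\Phi_\Gamma$ is injective; (2) for every $\gamma\in\mathcal{C}(\Gamma)$, the string $\Phi_\Gamma(\gamma)$ contains no two consecutive ones; (3) for every $\gamma\in\mathcal{C}(\Gamma)$, $\Phi_\Gamma(\gamma)$ is not the string $1010\dots101$ of length $2n-1$.
   Context: An assembly graph is a finite connected graph (loops and multiple edges allowed) in which every vertex has degree $1$ or $4$ (a loop contributes $2$ to the degree), and at every degree-$4$ vertex a cyclic order (up to reversal) of its four incident half-edges is fixed; two half-edges at a vertex are neighbours if adjacent in this cyclic order. A transverse path is a path between two degree-$1$ vertices with pairwise distinct edges such that at each intermediate vertex the entering and leaving half-edges are not neighbours. A simple assembly graph has a transverse path traversing every edge exactly once (Eulerian transversal). Writing the degree-$4$ vertices in the order visited gives a word $w_\Gamma$ of length $2n$ in which each vertex occurs twice; the edges are enumerated by $e_i=(w_\Gamma[i],w_\Gamma[i+1])$, $i=1,\dots,2n-1$ (the transversal edge between its $i$-th and $(i+1)$-th visits to degree-$4$ vertices; edges at degree-$1$ vertices are not enumerated). A polygonal path is a path $v_0e_1v_1\dots e_\ell v_\ell$ ($\ell\ge0$) with pairwise distinct degree-$4$ vertices such that $e_i,e_{i+1}$ are neighbours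 at $v_i$; a single vertex is a polygonal path. A Hamiltonian set of polygonal paths is a set of pairwise vertex-disjoint polygonal paths covering all degree-$4$ vertices; $\mathcal{C}(\Gamma)$ is the collection of these. -}

module Defs where

open import Data.Nat using (ℕ; zero; suc; _*_)
open import Data.Fin using (Fin; zero; suc; toℕ; inject₁) renaming (_≟_ to _≟ᶠ_)
open import Data.Bool using (Bool; true; false; not)
open import Data.Product using (Σ; _×_; _,_; ∃)
open import Data.Sum using (_⊎_)
open import Data.Unit using (⊤)
open import Data.List using (List; []; _∷_; map; length; lookup; reverse)
open import Data.List.Membership.Propositional using (_∈_; _∉_)
open import Data.List.Relation.Unary.All using (All)
open import Data.List.Relation.Unary.Any using (Any; any?)
open import Data.List.Relation.Unary.Unique.Propositional using (Unique)
open import Relation.Nullary using (¬_; does)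
open import Relation.Binary.PropositionalEquality using (_≡_; _≢_)

-- A simple assembly graph Γ with n = suc m degree-4 vertices is encoded by
-- the word w_Γ of its Eulerian transversal: a map from the 2n positions
-- (0-indexed) to the vertices Fin n in which every vertex occurs exactly twice.
--   * internal (enumerated) edges: e_{j+1}, j : Fin (2n-1) = Fin (suc (2*m)),
--     joining the visits at positions j and j+1;
--   * the half-edges at a degree-4 vertex are the "in" and "out" half-edges of
--     its two visits; transversality of w_Γ forces the cyclic order, in which
--     two half-edges are neighbours iff they belong to different visits
--     (i.e. different positions).

Pos : ℕ → Set
Pos m = Fin (suc (suc (2 * m)))

Edge : ℕ → Set
Edge m = Fin (suc (2 * m))

Word : ℕ → Set
Word m = Pos m → Fin (suc m)

IsDOW : (m : ℕ) → Word m → Set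
IsDOW m w = (v : Fin (suc m)) → Σ (Pos m) λ p → Σ (Pos m) λ q →
  (p ≢ q) × (w p ≡ v) × (w q ≡ v) × ((r : Pos m) → w r ≡ v → (r ≡ p) ⊎ (r ≡ q))

module AG (m : ℕ) (w : Word m) where

  DirEdge : Set
  DirEdge = Edge m × Bool

  src : DirEdge → Pos m
  src (j , true)  = inject₁ j
  src (j , false) = suc j

  tgt : DirEdge → Pos m
  tgt (j , true)  = suc j
  tgt (j , false) = inject₁ j

  flip : DirEdge → DirEdge
  flip (j , b) = (j , not b)

  data RawPath : Set where
    vtx  : Fin (suc m) → RawPath
    walk : DirEdge → List DirEdge → RawPath

  vertices : RawPath → List (Fin (suc m))
  vertices (vtx v)     = v ∷ []
  vertices (walk d ds) = w (src d) ∷ map (λ e → w (tgt e)) (d ∷ ds)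

  edgesOf : RawPath → List (Edge m)
  edgesOf (vtx v)     = []
  edgesOf (walk d ds) = map (λ e → Data.Product.proj₁ e) (d ∷ ds)

  revPath : RawPath → RawPath
  revPath (vtx v) = vtx v
  revPath (walk d ds) with reverse (map flip (d ∷ ds))
  ... | []       = vtx (w (src d))   -- impossible case
  ... | e ∷ es   = walk e es

  Neighbours : Pos m → Pos m → Set
  Neighbours p q = (w p ≡ w q) × (p ≢ q)

  Chain : DirEdge → List DirEdge → Set
  Chain d []         = ⊤
  Chain d (d' ∷ ds)  = (w (tgt d) ≡ w (src d')) × Neighbours (tgt d) (src d') × Chain d' ds

  IsPolygonal : RawPath → Set
  IsPolygonal (vtx v)     = ⊤
  IsPolygonal (walk d ds) = Chain d ds × Unique (vertices (walk d ds))

  IsHamiltonian : List RawPath → Set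
  IsHamiltonian γ =
    All IsPolygonal γ ×
    ((i j : Fin (length γ)) → i ≢ j → (v : Fin (suc m)) →
       v ∈ vertices (lookup γ i) → v ∉ vertices (lookup γ j)) ×
    ((v : Fin (suc m)) → Any (λ P → v ∈ vertices P) γ)

  SamePath : RawPath → RawPath → Set
  SamePath P Q = (P ≡ Q) ⊎ (P ≡ revPath Q)

  SameSet : List RawPath → List RawPath → Set
  SameSet γ δ = ((P : RawPath) → P ∈ γ → Any (SamePath P) δ) ×
                ((Q : RawPath) → Q ∈ δ → Any (SamePath Q) γ)

  Φ : List RawPath → Edge m → Bool
  Φ γ i = does (any? (λ P → any? (λ e → e ≟ᶠ i) (edgesOf P)) γ)

-- the string 1010…101 of length 2n-1 (0-indexed: 1 at even indices)
alternating : (m : ℕ) → Edge m → Bool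
alternating m i = even (toℕ i)
  where
  even : ℕ → Bool
  even zero    = true
  even (suc k) = not (even k)

{-# OPTIONS --safe #-}
-- A polygonal path enters each vertex by one visit of the transversal and leaves
-- by the other, so no visit is an end of two of its edges, and its start vertex
-- is an end of its first edge only. Consecutive edges e_i, e_(i+1) share a visit,
-- so they are never both used. If Φ(γ) were 1010…101, every visit would be an end
-- of a used edge, so the start vertex of a path of γ would be used at both of its
-- visits. For injectivity: as the paths are vertex-disjoint, the path of δ through
-- the start of a path P of γ has exactly the edges of P; that start is not interior
-- to it (an interior vertex is an end of two edges), and a polygonal path is
-- determined by its edge set and its start.
module Submission where

open import Defs
open import Data.Nat using (ℕ; zero; suc; _*_; _+_; _<_; s≤s)
open import Data.Nat.Properties using (m≤m+n; suc-injective; +-suc; +-identityʳ; 1+n≢n)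
open import Data.Fin using (Fin; zero; suc; toℕ; inject₁; fromℕ<) renaming (_≟_ to _≟ᶠ_)
open import Data.Fin.Properties using (toℕ-injective; toℕ-inject₁; toℕ-fromℕ<)
open import Data.Bool using (Bool; true; false; not)
open import Data.Bool.Properties using (not-involutive)
open import Data.List using (List; []; _∷_; map; lookup; reverse; [_]; _∷ʳ_)
open import Data.List.Properties
  using (unfold-reverse; map-++; map-∘; reverse-map; ∷-injectiveˡ; ∷-injectiveʳ)
open import Data.List.Relation.Unary.Any as Any using (Any; here; there; any?)
open import Data.List.Relation.Unary.Any.Properties using (lookup-index; reverse⁺; reverse⁻)
open import Data.List.Relation.Unary.All as All using ()
open import Data.List.Relation.Unary.All.Properties using (All¬⇒¬Any)
open import Data.List.Relation.Unary.AllPairs using (_∷_)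
open import Data.List.Relation.Unary.Unique.Propositional using (Unique)
open import Data.List.Membership.Propositional using (_∈_; _∉_; find; lose)
open import Data.List.Relation.Binary.Subset.Propositional using (_⊆_)
open import Data.Product using (∃-syntax; ∃₂; _×_; _,_; proj₁; proj₂)
open import Data.Sum using (_⊎_; inj₁; inj₂; swap)
open import Data.Unit using (⊤; tt)
open import Data.Empty using (⊥; ⊥-elim)
open import Function using (_∘_; id)
open import Relation.Nullary using (¬_; Dec; yes; no)
open import Relation.Nullary.Decidable using (dec-true)
open import Relation.Binary.PropositionalEquality
  using (_≡_; _≢_; refl; sym; trans; cong; cong₂; subst; module ≡-Reasoning)

inject₁≢suc : ∀ {n} (i : Fin n) → inject₁ i ≢ suc i
inject₁≢suc i eq = 1+n≢n (trans (sym (cong toℕ eq)) (toℕ-inject₁ i))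

adjacent-suc≡inject₁ : ∀ {n} {i j : Fin n} → toℕ j ≡ suc (toℕ i) → suc i ≡ inject₁ j
adjacent-suc≡inject₁ {j = j} eq = toℕ-injective (trans (sym eq) (sym (toℕ-inject₁ j)))

Incident : ∀ {n} → Fin n → Fin (suc n) → Set
Incident e p = p ≡ inject₁ e ⊎ p ≡ suc e

incident-suc : ∀ {n} {e : Fin n} {p} → Incident e p → Incident (suc e) (suc p)
incident-suc (inj₁ refl) = inj₁ refl
incident-suc (inj₂ refl) = inj₂ refl

isEven : ℕ → Bool
isEven zero    = true
isEven (suc n) = not (isEven n)

isEven-double : ∀ n → isEven (n + n) ≡ true
isEven-double zero = refl
isEven-double (suc n) rewrite +-suc n n | not-involutive (isEven (n + n)) = isEven-double n

isEven-odd : ∀ n → isEven (suc (2 * n)) ≡ false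
isEven-odd n rewrite +-identityʳ n | isEven-double n = refl

even-edge-incident : ∀ n (p : Fin (suc n)) → isEven n ≡ false →
  ∃[ e ] Incident e p × isEven (toℕ e) ≡ true
even-edge-incident zero          zero                ()
even-edge-incident (suc n)       zero                _ = zero , inj₁ refl , refl
even-edge-incident (suc n)       (suc zero)          _ = zero , inj₂ refl , refl
even-edge-incident (suc zero)    (suc (suc ()))      _
even-edge-incident (suc (suc n)) (suc (suc p))       odd
  with even-edge-incident n p (trans (sym (not-involutive (isEven n))) odd)
... | e , inc , even = suc (suc e) , incident-suc (incident-suc inc) , trans (not-involutive _) even

n<1+2n : ∀ n → n < suc (2 * n)
n<1+2n n = s≤s (m≤m+n n _)

-- Defs keeps the parity function of `alternating` local, so it is reached
-- through an edge of index n.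
alternating-isEven : ∀ n {m} (i : Edge m) → toℕ i ≡ n → alternating m i ≡ isEven n
alternating-isEven zero    zero    _  = refl
alternating-isEven (suc n) (suc i) eq
  with toℕ i | suc-injective eq | toℕ (fromℕ< (n<1+2n n)) | toℕ-fromℕ< (n<1+2n n)
     | alternating-isEven n {n} (fromℕ< (n<1+2n n)) (toℕ-fromℕ< (n<1+2n n))
... | .n | refl | .n | refl | ih = cong not ih

module _ (m : ℕ) (w : Word m) where
  open AG m w

  Vertex : Set
  Vertex = Fin (suc m)

  targets : List DirEdge → List Vertex
  targets = map (λ e → w (tgt e))

  indices : List DirEdge → List (Edge m)
  indices = map proj₁

  src-flip : ∀ d → src (flip d) ≡ tgt d
  src-flip (_ , true)  = refl
  src-flip (_ , false) = refl

  tgt-flip : ∀ d → tgt (flip d) ≡ src d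
  tgt-flip (_ , true)  = refl
  tgt-flip (_ , false) = refl

  incident-src : ∀ d → Incident (proj₁ d) (src d)
  incident-src (_ , true)  = inj₁ refl
  incident-src (_ , false) = inj₂ refl

  incident-tgt : ∀ d → Incident (proj₁ d) (tgt d)
  incident-tgt (_ , true)  = inj₂ refl
  incident-tgt (_ , false) = inj₁ refl

  incident⇒src⊎tgt : ∀ d {p} → Incident (proj₁ d) p → p ≡ src d ⊎ p ≡ tgt d
  incident⇒src⊎tgt (_ , true)  = id
  incident⇒src⊎tgt (_ , false) = swap

  dir-edge-≡ : ∀ {d e} → proj₁ d ≡ proj₁ e → src d ≡ src e → d ≡ e
  dir-edge-≡ {_ , true}  {_ , true}  refl _  = refl
  dir-edge-≡ {_ , false} {_ , false} refl _  = refl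
  dir-edge-≡ {j , true}  {_ , false} refl eq = ⊥-elim (inject₁≢suc j eq)
  dir-edge-≡ {j , false} {_ , true}  refl eq = ⊥-elim (inject₁≢suc j (sym eq))

  Turn : DirEdge → DirEdge → Set
  Turn d e = tgt d ≢ src e

  turn-flip : ∀ {d e} → Turn d e → Turn (flip e) (flip d)
  turn-flip {d} {e} turn eq =
    turn (trans (sym (src-flip d)) (trans (sym eq) (tgt-flip e)))

  TurnsInto : DirEdge → List DirEdge → Set
  TurnsInto d []      = ⊤
  TurnsInto d (e ∷ _) = Turn d e

  LastTurnsInto : List DirEdge → DirEdge → Set
  LastTurnsInto []          e = ⊤
  LastTurnsInto (d ∷ [])    e = Turn d e
  LastTurnsInto (_ ∷ d ∷ L) e = LastTurnsInto (d ∷ L) e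

  -- `IsPolygonal` unfolded one edge at a time: each vertex of the walk only
  -- has to avoid the vertices after it.
  data Walk : Vertex → List DirEdge → Set where
    []   : ∀ {v} → Walk v []
    step : ∀ {v d L} → w (src d) ≡ v → v ∉ targets (d ∷ L) → TurnsInto d L →
           Walk (w (tgt d)) L → Walk v (d ∷ L)

  end : Vertex → List DirEdge → Vertex
  end v []      = v
  end v (d ∷ L) = end (w (tgt d)) L

  chain⇒walk : ∀ {v d ds} → w (src d) ≡ v → Chain d ds → Unique (v ∷ targets (d ∷ ds)) →
    Walk v (d ∷ ds)
  chain⇒walk {ds = []}    s _ (v∉ ∷ _) = step s (All¬⇒¬Any v∉) tt []
  chain⇒walk {ds = _ ∷ _} s (meet , (_ , turn) , chain) (v∉ ∷ unique) =
    step s (All¬⇒¬Any v∉) turn (chain⇒walk (sym meet) chain unique)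

  polygonal⇒walk : ∀ {d ds} → IsPolygonal (walk d ds) → Walk (w (src d)) (d ∷ ds)
  polygonal⇒walk (chain , unique) = chain⇒walk refl chain unique

  start-∉-targets : ∀ {v L} → Walk v L → v ∉ targets L
  start-∉-targets []              ()
  start-∉-targets (step _ v∉ _ _) = v∉

  incident-∈-vertices : ∀ {v L i p} → Walk v L → i ∈ indices L → Incident i p → w p ∈ v ∷ targets L
  incident-∈-vertices (step {d = d} s _ _ _) (here refl) inc with incident⇒src⊎tgt d inc
  ... | inj₁ refl = here s
  ... | inj₂ refl = there (here refl)
  incident-∈-vertices (step _ _ _ W) (there i∈) inc = there (incident-∈-vertices W i∈ inc)

  tail-avoids-start : ∀ {v d L i p} → Walk v (d ∷ L) → i ∈ indices L → Incident i p → w p ≢ v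
  tail-avoids-start (step _ v∉ _ W) i∈ inc wp≡v =
    v∉ (subst (_∈ _) wp≡v (incident-∈-vertices W i∈ inc))

  head-∉-tail : ∀ {v d L} → Walk v (d ∷ L) → proj₁ d ∉ indices L
  head-∉-tail {d = d} W@(step s _ _ _) d∈ = tail-avoids-start W d∈ (incident-src d) s

  at-start⇒head : ∀ {v d L i p} → Walk v (d ∷ L) → i ∈ indices (d ∷ L) → Incident i p → w p ≡ v →
    i ≡ proj₁ d × p ≡ src d
  at-start⇒head {d = d} (step _ v∉ _ _) (here refl) inc wp≡v with incident⇒src⊎tgt d inc
  ... | inj₁ p≡src = refl , p≡src
  ... | inj₂ refl  = ⊥-elim (v∉ (here (sym wp≡v)))
  at-start⇒head W (there i∈) inc wp≡v = ⊥-elim (tail-avoids-start W i∈ inc wp≡v)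

  -- At its start the head edge is alone; at its end it meets only the next
  -- edge, which leaves by the other visit.
  head-shares-no-visit : ∀ {v d L j p} → Walk v (d ∷ L) → j ∈ indices L →
    Incident (proj₁ d) p → Incident j p → ⊥
  head-shares-no-visit {L = []} _ ()
  head-shares-no-visit {d = d} {L = _ ∷ _} W@(step s _ turn W′) j∈ inc-d inc-j
    with incident⇒src⊎tgt d inc-d
  ... | inj₁ refl = tail-avoids-start W j∈ inc-j s
  ... | inj₂ refl = turn (proj₂ (at-start⇒head W′ j∈ inc-j refl))

  visit-used-once : ∀ {v L i j p} → Walk v L → i ∈ indices L → j ∈ indices L →
    Incident i p → Incident j p → i ≡ j
  visit-used-once (step _ _ _ _) (here refl) (here refl) _ _ = refl
  visit-used-once W@(step _ _ _ _) (here refl) (there j∈) inc-i inc-j =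
    ⊥-elim (head-shares-no-visit W j∈ inc-i inc-j)
  visit-used-once W@(step _ _ _ _) (there i∈) (here refl) inc-i inc-j =
    ⊥-elim (head-shares-no-visit W i∈ inc-j inc-i)
  visit-used-once (step _ _ _ W) (there i∈) (there j∈) inc-i inc-j =
    visit-used-once W i∈ j∈ inc-i inc-j

  Touches : Edge m → Vertex → Set
  Touches i x = ∃[ p ] Incident i p × w p ≡ x

  interior⇒touched-twice : ∀ {v L x} → Walk v L → x ∈ v ∷ targets L → x ≢ v → x ≢ end v L →
    ∃₂ λ i j → i ∈ indices L × j ∈ indices L × Touches i x × Touches j x × i ≢ j
  interior⇒touched-twice _ (here x≡v) x≢v _ = ⊥-elim (x≢v x≡v)
  interior⇒touched-twice {L = _ ∷ []} _ (there (here x≡end)) _ x≢end = ⊥-elim (x≢end x≡end)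
  interior⇒touched-twice {L = d ∷ d′ ∷ _} W@(step _ _ _ (step s′ _ _ _)) (there (here refl)) _ _ =
    proj₁ d , proj₁ d′ , here refl , there (here refl)
    , (tgt d , incident-tgt d , refl) , (src d′ , incident-src d′ , s′)
    , head-∉-tail W ∘ here
  interior⇒touched-twice (step _ _ _ W) (there (there x∈)) _ x≢end
    with interior⇒touched-twice W (there x∈) (λ x≡ → start-∉-targets W (subst (_∈ _) x≡ x∈)) x≢end
  ... | i , j , i∈ , j∈ , touch-i , touch-j , i≢j =
    i , j , there i∈ , there j∈ , touch-i , touch-j , i≢j

  tail-⊆ : ∀ {v d L M} → Walk v (d ∷ L) → indices (d ∷ L) ⊆ indices (d ∷ M) →
    indices L ⊆ indices M
  tail-⊆ W L⊆M i∈ with L⊆M (there i∈)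
  ... | here refl = ⊥-elim (head-∉-tail W i∈)
  ... | there i∈M = i∈M

  -- The first edge is the only edge at the start, and its direction is fixed by
  -- the visit it leaves from.
  same-start-≡ : ∀ {u L M} → Walk u L → Walk u M → indices L ⊆ indices M → indices M ⊆ indices L →
    L ≡ M
  same-start-≡ [] [] _ _ = refl
  same-start-≡ [] (step _ _ _ _) _ M⊆L with M⊆L (here refl)
  ... | ()
  same-start-≡ (step _ _ _ _) [] L⊆M _ with L⊆M (here refl)
  ... | ()
  same-start-≡ WL@(step {d = d} s _ _ WL′) WM@(step {d = f} _ _ _ WM′) L⊆M M⊆L
    with at-start⇒head WM (L⊆M (here refl)) (incident-src d) s
  ... | i≡ , src≡ with dir-edge-≡ {d} {f} i≡ src≡
  ... | refl = cong (d ∷_) (same-start-≡ WL′ WM′ (tail-⊆ WL L⊆M) (tail-⊆ WM M⊆L))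

  revList : List DirEdge → List DirEdge
  revList L = reverse (map flip L)

  revList-∷ : ∀ d L → revList (d ∷ L) ≡ revList L ∷ʳ flip d
  revList-∷ d L = unfold-reverse (flip d) (map flip L)

  revPath-walk : ∀ {d ds e es} → revList (e ∷ es) ≡ d ∷ ds → revPath (walk e es) ≡ walk d ds
  revPath-walk eq rewrite eq = refl

  indices-revList : ∀ L → indices (revList L) ≡ reverse (indices L)
  indices-revList L = trans (reverse-map proj₁ (map flip L)) (cong reverse (sym (map-∘ L)))

  revList-⊆ : ∀ L → indices (revList L) ⊆ indices L
  revList-⊆ L i∈ = reverse⁻ (subst (_ ∈_) (indices-revList L) i∈)

  ⊆-revList : ∀ L → indices L ⊆ indices (revList L)
  ⊆-revList L i∈ = subst (_ ∈_) (sym (indices-revList L)) (reverse⁺ i∈)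

  end-∷ʳ : ∀ v L e → end v (L ∷ʳ e) ≡ w (tgt e)
  end-∷ʳ v []      e = refl
  end-∷ʳ v (d ∷ L) e = end-∷ʳ (w (tgt d)) L e

  end-revList : ∀ {v L} → Walk v L → end (end v L) (revList L) ≡ v
  end-revList [] = refl
  end-revList {L = d ∷ L} (step s _ _ _) = begin
    end _ (revList (d ∷ L))    ≡⟨ cong (end _) (revList-∷ d L) ⟩
    end _ (revList L ∷ʳ flip d) ≡⟨ end-∷ʳ _ (revList L) (flip d) ⟩
    w (tgt (flip d))            ≡⟨ cong w (tgt-flip d) ⟩
    w (src d)                   ≡⟨ s ⟩
    _                           ∎
    where open ≡-Reasoning

  vertices-revList : ∀ {v L} → Walk v L → end v L ∷ targets (revList L) ≡ reverse (v ∷ targets L)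
  vertices-revList [] = refl
  vertices-revList {v} {d ∷ L} (step s _ _ W) = begin
    end y L ∷ targets (revList (d ∷ L))
      ≡⟨ cong (λ R → end y L ∷ targets R) (revList-∷ d L) ⟩
    end y L ∷ targets (revList L ∷ʳ flip d)
      ≡⟨ cong (end y L ∷_) (map-++ _ (revList L) [ flip d ]) ⟩
    (end y L ∷ targets (revList L)) ∷ʳ w (tgt (flip d))
      ≡⟨ cong₂ _∷ʳ_ (vertices-revList W) (trans (cong w (tgt-flip d)) s) ⟩
    reverse (y ∷ targets L) ∷ʳ v
      ≡⟨ sym (unfold-reverse v (y ∷ targets L)) ⟩
    reverse (v ∷ y ∷ targets L) ∎
    where
    open ≡-Reasoning
    y : Vertex
    y = w (tgt d)

  last-turns-∷ʳ : ∀ L {d e} → Turn d e → LastTurnsInto (L ∷ʳ d) e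
  last-turns-∷ʳ []          turn = turn
  last-turns-∷ʳ (_ ∷ [])    turn = turn
  last-turns-∷ʳ (_ ∷ d ∷ L) turn = last-turns-∷ʳ (d ∷ L) turn

  last-turns-revList : ∀ d L → TurnsInto d L → LastTurnsInto (revList L) (flip d)
  last-turns-revList d []      _    = tt
  last-turns-revList d (e ∷ L) turn =
    subst (λ R → LastTurnsInto R (flip d)) (sym (revList-∷ e L))
      (last-turns-∷ʳ (revList L) (turn-flip {d} {e} turn))

  ∉-targets-∷ʳ : ∀ {x} L e → x ∉ targets L → x ≢ w (tgt e) → x ∉ targets (L ∷ʳ e)
  ∉-targets-∷ʳ []      e _  x≢ (here x≡) = x≢ x≡
  ∉-targets-∷ʳ (_ ∷ _) e x∉ _  (here x≡) = x∉ (here x≡)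
  ∉-targets-∷ʳ (_ ∷ L) e x∉ x≢ (there x∈) = ∉-targets-∷ʳ L e (x∉ ∘ there) x≢ x∈

  walk-∷ʳ : ∀ {v L e} → Walk v L → w (src e) ≡ end v L → LastTurnsInto L e →
    w (tgt e) ∉ v ∷ targets L → Walk v (L ∷ʳ e)
  walk-∷ʳ {e = e} [] s _ new∉ =
    step s (∉-targets-∷ʳ [] e (λ ()) (new∉ ∘ here ∘ sym)) tt []
  walk-∷ʳ {e = e} (step {d = d} {L = []} s v∉ _ W) s′ last new∉ =
    step s (∉-targets-∷ʳ (d ∷ []) e v∉ (new∉ ∘ here ∘ sym)) last (walk-∷ʳ W s′ tt (new∉ ∘ there))
  walk-∷ʳ {e = e} (step {d = d} {L = L@(_ ∷ _)} s v∉ turn W) s′ last new∉ =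
    step s (∉-targets-∷ʳ (d ∷ L) e v∉ (new∉ ∘ here ∘ sym)) turn (walk-∷ʳ W s′ last (new∉ ∘ there))

  walk-reverse : ∀ {v L} → Walk v L → Walk (end v L) (revList L)
  walk-reverse [] = []
  walk-reverse (step {d = d} {L = L} s v∉ turn W) =
    subst (Walk _) (sym (revList-∷ d L))
      (walk-∷ʳ (walk-reverse W) (trans (cong w (src-flip d)) (sym (end-revList W)))
        (last-turns-revList d L turn) new∉)
    where
    new∉ : w (tgt (flip d)) ∉ end (w (tgt d)) L ∷ targets (revList L)
    new∉ v∈ = v∉ (subst (_∈ _) (trans (cong w (tgt-flip d)) s)
                   (reverse⁻ (subst (_ ∈_) (vertices-revList W) v∈)))

  -- A start vertex strictly inside the other walk would be met by two of its edges.
  walk-≡-or-reverse : ∀ {u v d L M} → Walk u (d ∷ L) → Walk v M → u ∈ v ∷ targets M →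
    indices (d ∷ L) ⊆ indices M → indices M ⊆ indices (d ∷ L) →
    (d ∷ L ≡ M) ⊎ (d ∷ L ≡ revList M)
  walk-≡-or-reverse {u} {v} {M = M} WL WM u∈M L⊆M M⊆L with u ≟ᶠ v | u ≟ᶠ end v M
  ... | yes refl | _ = inj₁ (same-start-≡ WL WM L⊆M M⊆L)
  ... | no _ | yes refl =
    inj₂ (same-start-≡ WL (walk-reverse WM) (⊆-revList M ∘ L⊆M) (M⊆L ∘ revList-⊆ M))
  ... | no u≢v | no u≢end with interior⇒touched-twice WM u∈M u≢v u≢end
  ... | i , j , i∈M , j∈M , (p , inc-i , wp) , (q , inc-j , wq) , i≢j =
    ⊥-elim (i≢j (trans (proj₁ (at-start⇒head WL (M⊆L i∈M) inc-i wp))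
                       (sym (proj₁ (at-start⇒head WL (M⊆L j∈M) inc-j wq)))))

  start : RawPath → Vertex
  start (vtx v)    = v
  start (walk d _) = w (src d)

  start∈vertices : ∀ P → start P ∈ vertices P
  start∈vertices (vtx _)    = here refl
  start∈vertices (walk _ _) = here refl

  Visits : RawPath → Pos m → Set
  Visits P p = ∃[ i ] i ∈ edgesOf P × Incident i p

  path-incident-∈-vertices : ∀ {P i p} → IsPolygonal P → i ∈ edgesOf P → Incident i p →
    w p ∈ vertices P
  path-incident-∈-vertices {walk _ _} poly = incident-∈-vertices (polygonal⇒walk poly)

  path-visit-used-once : ∀ {P i j p} → IsPolygonal P → i ∈ edgesOf P → j ∈ edgesOf P →
    Incident i p → Incident j p → i ≡ j
  path-visit-used-once {walk _ _} poly = visit-used-once (polygonal⇒walk poly)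

  start-visited-once : ∀ {P p q} → IsPolygonal P → Visits P p → Visits P q →
    w p ≡ start P → w q ≡ start P → p ≡ q
  start-visited-once {walk d ds} poly (_ , i∈ , inc-i) (_ , j∈ , inc-j) wp wq =
    trans (proj₂ (at-start⇒head W i∈ inc-i wp)) (sym (proj₂ (at-start⇒head W j∈ inc-j wq)))
    where
    W : Walk (w (src d)) (d ∷ ds)
    W = polygonal⇒walk poly

  same-edges⇒same-path : ∀ {P Q} → IsPolygonal P → IsPolygonal Q → start P ∈ vertices Q →
    edgesOf P ⊆ edgesOf Q → edgesOf Q ⊆ edgesOf P → SamePath P Q
  same-edges⇒same-path {vtx _} {vtx _} _ _ (here refl) _ _ = inj₁ refl
  same-edges⇒same-path {vtx _} {walk _ _} _ _ _ _ Q⊆P with Q⊆P (here refl)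
  ... | ()
  same-edges⇒same-path {walk _ _} {vtx _} _ _ _ P⊆Q _ with P⊆Q (here refl)
  ... | ()
  same-edges⇒same-path {walk d ds} {walk f fs} polyP polyQ s∈Q P⊆Q Q⊆P
    with walk-≡-or-reverse (polygonal⇒walk polyP) (polygonal⇒walk polyQ) s∈Q P⊆Q Q⊆P
  ... | inj₁ eq = inj₁ (cong₂ walk (∷-injectiveˡ eq) (∷-injectiveʳ eq))
  ... | inj₂ eq = inj₂ (sym (revPath-walk {d} {ds} {f} {fs} (sym eq)))

  used? : ∀ γ i → Dec (Any (λ P → Any (_≡ i) (edgesOf P)) γ)
  used? γ i = any? (λ P → any? (_≟ᶠ i) (edgesOf P)) γ

  Φ≡true⇒ : ∀ {γ i} → Φ γ i ≡ true → ∃[ P ] P ∈ γ × i ∈ edgesOf P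
  Φ≡true⇒ {γ} {i} with used? γ i
  ... | yes used with find used
  ...   | P , P∈ , i∈ = λ _ → P , P∈ , Any.map sym i∈
  Φ≡true⇒ | no _ = λ ()

  ⇒Φ≡true : ∀ {γ P i} → P ∈ γ → i ∈ edgesOf P → Φ γ i ≡ true
  ⇒Φ≡true P∈ i∈ = dec-true (used? _ _) (lose P∈ (Any.map sym i∈))

  ham-polygonal : ∀ {γ P} → IsHamiltonian γ → P ∈ γ → IsPolygonal P
  ham-polygonal (polygonal , _ , _) = All.lookup polygonal

  ham-covers : ∀ {γ} → IsHamiltonian γ → ∀ x → ∃[ P ] P ∈ γ × x ∈ vertices P
  ham-covers (_ , _ , covers) x = find (covers x)

  ham-disjoint : ∀ {γ P Q x} → IsHamiltonian γ → P ∈ γ → Q ∈ γ →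
    x ∈ vertices P → x ∈ vertices Q → P ≡ Q
  ham-disjoint {γ} {x = x} (_ , disjoint , _) P∈ Q∈ xP xQ with Any.index P∈ ≟ᶠ Any.index Q∈
  ... | yes k≡k′ = trans (lookup-index P∈) (trans (cong (lookup γ) k≡k′) (sym (lookup-index Q∈)))
  ... | no k≢k′  = ⊥-elim (disjoint _ _ k≢k′ x (at P∈ xP) (at Q∈ xQ))
    where
    at : ∀ {R} (R∈ : R ∈ γ) → x ∈ vertices R → x ∈ vertices (lookup γ (Any.index R∈))
    at R∈ = subst (λ R → x ∈ vertices R) (lookup-index R∈)

  used-edge-∈-path : ∀ {γ P i p} → IsHamiltonian γ → Φ γ i ≡ true → Incident i p → P ∈ γ →
    w p ∈ vertices P → i ∈ edgesOf P
  used-edge-∈-path H used inc P∈ wp∈P with Φ≡true⇒ used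
  ... | P′ , P′∈ , i∈P′
    with ham-disjoint H P′∈ P∈ (path-incident-∈-vertices (ham-polygonal H P′∈) i∈P′ inc) wp∈P
  ... | refl = i∈P′

  -- Both the start and the edge set are returned so that the induction can
  -- propagate membership in Q in either direction along the walk.
  walk-within : ∀ {δ Q v L x} → IsHamiltonian δ → Q ∈ δ → (∀ {i} → i ∈ indices L → Φ δ i ≡ true) →
    Walk v L → x ∈ v ∷ targets L → x ∈ vertices Q → v ∈ vertices Q × indices L ⊆ edgesOf Q
  walk-within _ _ _ [] (here refl) x∈Q = x∈Q , λ ()
  walk-within {Q = Q} H Q∈ used (step {d = d} s _ _ W) (here refl) v∈Q = v∈Q , λ
    { (here refl) → d∈Q
    ; (there i∈)  → proj₂ (walk-within H Q∈ (used ∘ there) W (here refl) tgt∈Q) i∈ }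
    where
    d∈Q : proj₁ d ∈ edgesOf Q
    d∈Q = used-edge-∈-path H (used (here refl)) (incident-src d) Q∈ (subst (_∈ _) (sym s) v∈Q)
    tgt∈Q : w (tgt d) ∈ vertices Q
    tgt∈Q = path-incident-∈-vertices (ham-polygonal H Q∈) d∈Q (incident-tgt d)
  walk-within {Q = Q} H Q∈ used (step {d = d} {L = L} s _ _ W) (there x∈) x∈Q =
    subst (_∈ _) s (path-incident-∈-vertices (ham-polygonal H Q∈) d∈Q (incident-src d)) , λ
    { (here refl) → d∈Q
    ; (there i∈)  → proj₂ tail i∈ }
    where
    tail : w (tgt d) ∈ vertices Q × indices L ⊆ edgesOf Q
    tail = walk-within H Q∈ (used ∘ there) W x∈ x∈Q
    d∈Q : proj₁ d ∈ edgesOf Q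
    d∈Q = used-edge-∈-path H (used (here refl)) (incident-tgt d) Q∈ (proj₁ tail)

  path-within : ∀ {δ P Q x} → IsHamiltonian δ → Q ∈ δ → IsPolygonal P →
    (∀ {i} → i ∈ edgesOf P → Φ δ i ≡ true) → x ∈ vertices P → x ∈ vertices Q → edgesOf P ⊆ edgesOf Q
  path-within {P = vtx _} _ _ _ _ _ _ ()
  path-within {P = walk _ _} H Q∈ poly used x∈P x∈Q =
    proj₂ (walk-within H Q∈ used (polygonal⇒walk poly) x∈P x∈Q)

  Φ≡⇒path-matched : ∀ {γ δ} → IsHamiltonian γ → IsHamiltonian δ → (∀ i → Φ γ i ≡ Φ δ i) →
    ∀ P → P ∈ γ → Any (SamePath P) δ
  Φ≡⇒path-matched Hγ Hδ Φ≡ P P∈γ with ham-covers Hδ (start P)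
  ... | Q , Q∈δ , s∈Q = lose Q∈δ (same-edges⇒same-path polyP polyQ s∈Q P⊆Q Q⊆P)
    where
    polyP : IsPolygonal P
    polyP = ham-polygonal Hγ P∈γ
    polyQ : IsPolygonal Q
    polyQ = ham-polygonal Hδ Q∈δ
    P⊆Q : edgesOf P ⊆ edgesOf Q
    P⊆Q = path-within Hδ Q∈δ polyP (λ i∈ → trans (sym (Φ≡ _)) (⇒Φ≡true P∈γ i∈))
            (start∈vertices P) s∈Q
    Q⊆P : edgesOf Q ⊆ edgesOf P
    Q⊆P = path-within Hγ P∈γ polyQ (λ i∈ → trans (Φ≡ _) (⇒Φ≡true Q∈δ i∈))
            s∈Q (start∈vertices P)

  Φ-injective : ∀ γ δ → IsHamiltonian γ → IsHamiltonian δ → (∀ i → Φ γ i ≡ Φ δ i) → SameSet γ δ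
  Φ-injective _ _ Hγ Hδ Φ≡ = Φ≡⇒path-matched Hγ Hδ Φ≡ , Φ≡⇒path-matched Hδ Hγ (sym ∘ Φ≡)

  Φ-no-adjacent-ones : ∀ γ → IsHamiltonian γ → ∀ i j → toℕ j ≡ suc (toℕ i) →
    ¬ (Φ γ i ≡ true × Φ γ j ≡ true)
  Φ-no-adjacent-ones γ H i j j≡1+i (used-i , used-j) with Φ≡true⇒ used-i
  ... | P , P∈ , i∈P = 1+n≢n (trans (sym j≡1+i) (cong toℕ (sym i≡j)))
    where
    shared : suc i ≡ inject₁ j
    shared = adjacent-suc≡inject₁ j≡1+i
    poly : IsPolygonal P
    poly = ham-polygonal H P∈
    j∈P : j ∈ edgesOf P
    j∈P = used-edge-∈-path H used-j (inj₁ shared) P∈ (path-incident-∈-vertices poly i∈P (inj₂ refl))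
    i≡j : i ≡ j
    i≡j = path-visit-used-once poly i∈P j∈P (inj₂ refl) (inj₁ shared)

  alternating⇒every-visit-used : ∀ {γ} → (∀ i → Φ γ i ≡ alternating m i) →
    ∀ p → ∃[ i ] Φ γ i ≡ true × Incident i p
  alternating⇒every-visit-used {γ} Φ≡alt p with even-edge-incident _ p (isEven-odd m)
  ... | i , inc , even =
    i , trans (Φ≡alt i) (trans (alternating-isEven (toℕ i) {m} i refl) even) , inc

  Φ-not-alternating : IsDOW m w → ∀ γ → IsHamiltonian γ → ¬ (∀ i → Φ γ i ≡ alternating m i)
  Φ-not-alternating dow γ H Φ≡alt with ham-covers H zero
  ... | P , P∈ , _ with dow (start P)
  ... | p , q , p≢q , wp , wq , _ =
    p≢q (start-visited-once (ham-polygonal H P∈) (visited p wp) (visited q wq) wp wq)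
    where
    visited : ∀ r → w r ≡ start P → Visits P r
    visited r wr with alternating⇒every-visit-used {γ} Φ≡alt r
    ... | i , used , inc =
      i , used-edge-∈-path H used inc P∈ (subst (_∈ vertices P) (sym wr) (start∈vertices P)) , inc

proposition3p5 : (m : ℕ) → (w : Word m) → IsDOW m w →
    ((γ δ : List (AG.RawPath m w)) → AG.IsHamiltonian m w γ → AG.IsHamiltonian m w δ →
      ((i : Edge m) → AG.Φ m w γ i ≡ AG.Φ m w δ i) → AG.SameSet m w γ δ)
    × ((γ : List (AG.RawPath m w)) → AG.IsHamiltonian m w γ → (i j : Edge m) →
      toℕ j ≡ suc (toℕ i) → ¬ ((AG.Φ m w γ i ≡ true) × (AG.Φ m w γ j ≡ true)))
    × ((γ : List (AG.RawPath m w)) → AG.IsHamiltonian m w γ →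
      ¬ ((i : Edge m) → AG.Φ m w γ i ≡ alternating m i))
proposition3p5 m w dow = Φ-injective m w , Φ-no-adjacent-ones m w , Φ-not-alternating m w dow
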